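{- Let $G$ be a graph and $M$ a matching in $G$. If $H$ is a subgraph of $G_M$ with at least one edge, all of whose edges are red, then either $H$ contains at least three vertices of degree at most $2$ in $H$, or $H$ consists of exactly two vertices and one edge between them.
   Context: All graphs are finite, simple and undirected. For a matching $M$ in $G$, $G[M]$ is the subgraph of $G$ induced by the endpoints of edges of $M$, and $G_M$ is the simple graph obtained from $G[M]$ by contracting each edge $xy\in M$ to a vertex $v_{xy}$ and removing parallel edges (so $v_{ab}v_{cd}\in E(G_M)$ iff some edge of $G$ joins a vertex of $\{a,b\}$ to a vertex of $\{c,d\}$). Each edge $v_{ab}v_{cd}$ of $G_M$ is coloured red if there exist labellings with $\{\{p,q\},\{r,s\}\}=\{\{a,b\},\{c,d\}\}$ such that $pr\in E(G)$, $d_{G[M]}(p)=2$ and $d_{G[M]}(q)>2$; otherwise it is coloured blue. -}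

module Defs where

open import Data.Nat using (ℕ)
open import Data.Fin using (Fin)
open import Data.Bool using (Bool; not)
open import Data.Product using (Σ; ∃; ∃-syntax; _×_; _,_)
open import Data.Sum using (_⊎_)
open import Relation.Nullary using (¬_)
open import Relation.Unary using (Decidable) renaming (_∈_ to _∈ᵤ_)
open import Relation.Binary using (Symmetric; Irreflexive) renaming (Decidable to Decidable₂)
open import Relation.Binary.PropositionalEquality using (_≡_; _≢_)
open import Function.Definitions using (Injective)

record Graph (n : ℕ) : Set₁ where
  field
    Adj     : Fin n → Fin n → Set
    adj?    : Decidable₂ Adj
    sym     : Symmetric Adj
    irrefl  : Irreflexive _≡_ Adj

-- A matching M = {x_i y_i : i < m} in G, given by an injective labelling of
-- its 2m endpoints: edge i has endpoints ends i false and ends i true.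
record Matching {n : ℕ} (G : Graph n) (m : ℕ) : Set where
  open Graph G
  field
    ends      : Fin m → Bool → Fin n
    ends-inj  : ∀ i j a b → ends i a ≡ ends j b → (i ≡ j × a ≡ b)
    ends-edge : ∀ i → Adj (ends i Bool.false) (ends i Bool.true)

module _ {n : ℕ} (G : Graph n) {m : ℕ} (M : Matching G m) where
  open Graph G
  open Matching M

  -- v is an endpoint of an edge of M, i.e. a vertex of G[M]
  InVM : Fin n → Set
  InVM v = ∃[ i ] ∃[ a ] ends i a ≡ v

  DegGM≥ : Fin n → ℕ → Set
  DegGM≥ p k = Σ (Fin k → Fin n) λ f →
    Injective _≡_ _≡_ f × (∀ t → InVM (f t) × Adj p (f t))

  DegGM≡2 : Fin n → Set
  DegGM≡2 p = DegGM≥ p 2 × ¬ DegGM≥ p 3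

  DegGM>2 : Fin n → Set
  DegGM>2 p = DegGM≥ p 3

  -- edge v_i v_j of G_M (contracted graph): i ≠ j and some edge of G joins the two M-edges
  EdgeGM : Fin m → Fin m → Set
  EdgeGM i j = i ≢ j × ∃[ a ] ∃[ b ] Adj (ends i a) (ends j b)

  RedDir : Fin m → Fin m → Set
  RedDir i j = ∃[ a ] ∃[ b ]
    (Adj (ends i a) (ends j b) × DegGM≡2 (ends i a) × DegGM>2 (ends i (not a)))

  Red : Fin m → Fin m → Set
  Red i j = EdgeGM i j × (RedDir i j ⊎ RedDir j i)

  record SubgraphGM : Set₁ where
    field
      V     : Fin m → Set
      V?    : Decidable V
      E     : Fin m → Fin m → Set
      E?    : Decidable₂ E
      E-sym : Symmetric E
      E-V   : ∀ {i j} → E i j → V i × V j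
      E-sub : ∀ {i j} → E i j → EdgeGM i j

module _ {m : ℕ} {n : ℕ} {G : Graph n} {M : Matching G m} (H : SubgraphGM G M) where
  open SubgraphGM H

  DegH≥ : Fin m → ℕ → Set
  DegH≥ i k = Σ (Fin k → Fin m) λ f → Injective _≡_ _≡_ f × (∀ t → E i (f t))

  DegH≤2 : Fin m → Set
  DegH≤2 i = ¬ DegH≥ i 3

  HasEdge : Set
  HasEdge = ∃[ i ] ∃[ j ] E i j

  AllRed : Set
  AllRed = ∀ {i j} → E i j → Red G M i j

  ThreeLowDeg : Set
  ThreeLowDeg = Σ (Fin 3 → Fin m) λ f →
    Injective _≡_ _≡_ f × (∀ t → V (f t) × DegH≤2 (f t))

  IsK2 : Set
  IsK2 = ∃[ i ] ∃[ j ] (i ≢ j × E i j × (∀ k → V k → (k ≡ i ⊎ k ≡ j)))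

-- Orient each edge v_i v_j of H from i to j when it has a red witness with {p, q} = e_i (both
-- orientations may occur).  The endpoint p is then determined by e_i, because d(p) = 2 < d(q),
-- and p has only one neighbour outside e_i, so every vertex of H has out-degree at most 1.  A
-- vertex of H-degree at least 3 ("high") thus has in-degree at least 2, and counting arcs at
-- their heads and at their tails gives  2·#high + indeg c ≤ #high + #low  for every vertex c that
-- is not high.  With at most two low vertices there are at most two high ones, and two adjacent
-- high vertices would have a common low neighbour c: an arc into c is excluded by the inequality,
-- and arcs from c to both by the out-degree bound.  So H has no high vertex, and then only the
-- two ends of an edge can be vertices of H.
module Submission where

open import Defs
open import Data.Nat using (ℕ; zero; suc; _+_; _≤_; _<_; z≤n; s≤s; _≤?_)
open import Data.Nat.Properties
  using ( ≤-refl; ≤-trans; <-≤-trans; ≤-pred; n≤1+n; ≰⇒>; ≤⇒≯; m≤m+n; m<m+n; +-comm; +-assoc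
        ; +-mono-≤; +-monoˡ-≤; +-monoʳ-≤; +-cancelˡ-≤; +-0-commutativeMonoid; module ≤-Reasoning )
open import Algebra.Properties.CommutativeMonoid.Sum +-0-commutativeMonoid
  using (sum-syntax; ∑-comm; ∑-distrib-+)
open import Data.Bool as Bool using (Bool; true; false; not)
open import Data.Bool.Properties using (¬-not)
open import Data.Empty using (⊥; ⊥-elim)
open import Data.Fin using (Fin; zero; suc; _≟_; inject≤)
open import Data.Fin.Patterns using (0F; 1F; 2F)
open import Data.Fin.Properties using (any?; injective⇒≤; inject≤-injective; suc-injective)
open import Data.Product using (Σ; ∃-syntax; _×_; _,_; proj₁; proj₂)
open import Data.Sum using (_⊎_; inj₁; inj₂; [_,_]′; map₂)
open import Data.Vec.Functional using ([]; _∷_)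
open import Function using (_∘_)
open import Function.Definitions using (Injective)
open import Level using (0ℓ)
open import Relation.Nullary using (Dec; yes; no; ¬_; contradiction)
open import Relation.Nullary.Decidable using (map′; _×-dec_; _⊎-dec_; ¬?)
open import Relation.Unary using (Pred; Decidable; _⊆_; _∪_)
open import Relation.Unary.Properties using (_∩?_)
open import Relation.Binary using (Rel) renaming (Decidable to Decidable₂)
open import Relation.Binary.PropositionalEquality
  using (_≡_; _≢_; refl; sym; trans; cong; subst; module ≡-Reasoning)

indicator : {P : Set} → Dec P → ℕ
indicator (yes _) = 1
indicator (no _)  = 0

module _ {m : ℕ} where

  count : {P : Pred (Fin m) 0ℓ} → Decidable P → ℕ
  count P? = ∑[ x < m ] indicator (P? x)

  Distinct : Pred (Fin m) 0ℓ → ℕ → Set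
  Distinct P k = Σ (Fin k → Fin m) λ f → Injective _≡_ _≡_ f × (∀ t → P (f t))

∑-mono-≤ : ∀ {m} {f g : Fin m → ℕ} → (∀ x → f x ≤ g x) → ∑[ x < m ] f x ≤ ∑[ x < m ] g x
∑-mono-≤ {zero}  f≤g = z≤n
∑-mono-≤ {suc m} f≤g = +-mono-≤ (f≤g zero) (∑-mono-≤ (f≤g ∘ suc))

∷-injective : ∀ {m k} {x : Fin m} {f : Fin k → Fin m} →
              Injective _≡_ _≡_ f → (∀ t → x ≢ f t) → Injective _≡_ _≡_ (x ∷ f)
∷-injective f-inj x∉f {zero}  {zero}  _  = refl
∷-injective f-inj x∉f {zero}  {suc t} eq = contradiction eq (x∉f t)
∷-injective f-inj x∉f {suc s} {zero}  eq = contradiction (sym eq) (x∉f s)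
∷-injective f-inj x∉f {suc s} {suc t} eq = cong suc (f-inj eq)

module _ {m : ℕ} {P : Pred (Fin m) 0ℓ} where

  distinct₁ : ∀ {a} → P a → Distinct P 1
  distinct₁ {a} pa = a ∷ [] , ∷-injective (λ { {()} }) (λ ()) , λ { 0F → pa }

  distinct₂ : ∀ {a b} → a ≢ b → P a → P b → Distinct P 2
  distinct₂ {a} {b} a≢b pa pb =
    a ∷ b ∷ [] ,
    ∷-injective {k = 1} (∷-injective (λ { {()} }) (λ ())) (λ { 0F → a≢b }) ,
    λ { 0F → pa ; 1F → pb }

  distinct₃ : ∀ {a b c} → a ≢ b → a ≢ c → b ≢ c → P a → P b → P c → Distinct P 3
  distinct₃ {a} {b} {c} a≢b a≢c b≢c pa pb pc =
    a ∷ b ∷ c ∷ [] ,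
    ∷-injective {k = 2} (∷-injective {k = 1} (∷-injective (λ { {()} }) (λ ())) (λ { 0F → b≢c }))
                        (λ { 0F → a≢b ; 1F → a≢c }) ,
    λ { 0F → pa ; 1F → pb ; 2F → pc }

record Enumeration {m : ℕ} (P : Pred (Fin m) 0ℓ) (c : ℕ) : Set where
  field
    element   : Fin c → Fin m
    injective : Injective _≡_ _≡_ element
    sound     : ∀ t → P (element t)
    complete  : ∀ {x} → P x → ∃[ t ] element t ≡ x

module _ {m : ℕ} {P : Pred (Fin (suc m)) 0ℓ} {c : ℕ} where

  enumeration-extend : (P₀? : Dec (P zero)) → Enumeration (P ∘ suc) c →
                       Enumeration P (indicator P₀? + c)
  enumeration-extend (yes p₀) e = record
    { element   = zero ∷ (suc ∘ element)
    ; injective = ∷-injective (λ eq → injective (suc-injective eq)) (λ _ ())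
    ; sound     = λ { zero → p₀ ; (suc t) → sound t }
    ; complete  = λ { {zero} _ → zero , refl
                    ; {suc x} px → let t , eq = complete px in suc t , cong suc eq }
    }
    where open Enumeration e
  enumeration-extend (no ¬p₀) e = record
    { element   = suc ∘ element
    ; injective = λ eq → injective (suc-injective eq)
    ; sound     = sound
    ; complete  = λ { {zero} p₀ → contradiction p₀ ¬p₀
                    ; {suc x} px → let t , eq = complete px in t , cong suc eq }
    }
    where open Enumeration e

enumerate : ∀ {m} {P : Pred (Fin m) 0ℓ} (P? : Decidable P) → Enumeration P (count P?)
enumerate {zero}  P? = record
  { element = λ () ; injective = λ { {()} } ; sound = λ () ; complete = λ { {()} } }
enumerate {suc m} P? = enumeration-extend (P? zero) (enumerate (P? ∘ suc))

module _ {m : ℕ} {P : Pred (Fin m) 0ℓ} (P? : Decidable P) where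

  distinct⇒≤count : ∀ {k} → Distinct P k → k ≤ count P?
  distinct⇒≤count {k} (f , f-inj , f∈P) = injective⇒≤ {f = index} index-injective
    where
    open Enumeration (enumerate P?)
    index : Fin k → Fin (count P?)
    index t = proj₁ (complete (f∈P t))
    index-injective : Injective _≡_ _≡_ index
    index-injective {s} {t} eq = f-inj (begin
      f s                 ≡⟨ proj₂ (complete (f∈P s)) ⟨
      element (index s)   ≡⟨ cong element eq ⟩
      element (index t)   ≡⟨ proj₂ (complete (f∈P t)) ⟩
      f t                 ∎)
      where open ≡-Reasoning

  ≤count⇒distinct : ∀ {k} → k ≤ count P? → Distinct P k
  ≤count⇒distinct k≤c =
    element ∘ (λ t → inject≤ t k≤c) ,
    (λ eq → inject≤-injective k≤c k≤c _ _ (injective eq)) ,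
    sound ∘ _
    where open Enumeration (enumerate P?)

  distinct? : ∀ k → Dec (Distinct P k)
  distinct? k = map′ ≤count⇒distinct distinct⇒≤count (k ≤? count P?)

  count-witness : 1 ≤ count P? → ∃[ x ] P x
  count-witness 1≤c = let f , _ , f∈P = ≤count⇒distinct 1≤c in f 0F , f∈P 0F

  count≤-of-¬distinct : ∀ {k} → ¬ Distinct P (suc k) → count P? ≤ k
  count≤-of-¬distinct ¬distinct = ≤-pred (≰⇒> (¬distinct ∘ ≤count⇒distinct))

module _ {P Q : Set} where

  indicator-mono : (P → Q) → (p : Dec P) (q : Dec Q) → indicator p ≤ indicator q
  indicator-mono P⇒Q (yes p) (yes _) = ≤-refl
  indicator-mono P⇒Q (yes p) (no ¬q) = contradiction (P⇒Q p) ¬q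
  indicator-mono P⇒Q (no _)  _       = z≤n

  indicator-⊎ : ∀ {S} → (P → Q ⊎ S) → (p : Dec P) (q : Dec Q) (s : Dec S) →
                indicator p ≤ indicator q + indicator s
  indicator-⊎ P⇒Q⊎S (no _)  _       _       = z≤n
  indicator-⊎ P⇒Q⊎S (yes p) (yes _) _       = s≤s z≤n
  indicator-⊎ P⇒Q⊎S (yes p) (no ¬q) (yes _) = ≤-refl
  indicator-⊎ P⇒Q⊎S (yes p) (no ¬q) (no ¬s) with P⇒Q⊎S p
  ... | inj₁ q = contradiction q ¬q
  ... | inj₂ s = contradiction s ¬s

  indicator-∩ : ∀ {S} → (P → S) → (Q → S) → (p : Dec P) (q : Dec Q) (s : Dec S) →
                indicator p + indicator q ≤ indicator s + indicator (p ×-dec q)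
  indicator-∩ P⇒S Q⇒S (yes p) (yes q) (yes _) = ≤-refl
  indicator-∩ P⇒S Q⇒S (yes p) _       (no ¬s) = contradiction (P⇒S p) ¬s
  indicator-∩ P⇒S Q⇒S (no _)  (yes q) (no ¬s) = contradiction (Q⇒S q) ¬s
  indicator-∩ P⇒S Q⇒S (yes p) (no _)  (yes _) = ≤-refl
  indicator-∩ P⇒S Q⇒S (no _)  (yes q) (yes _) = ≤-refl
  indicator-∩ P⇒S Q⇒S (no _)  (no _)  _       = z≤n

module _ {m : ℕ} {P Q : Pred (Fin m) 0ℓ} (P? : Decidable P) (Q? : Decidable Q) where

  count-mono : P ⊆ Q → count P? ≤ count Q?
  count-mono P⊆Q = ∑-mono-≤ λ x → indicator-mono P⊆Q (P? x) (Q? x)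

  count-⊎ : ∀ {S} (S? : Decidable S) → P ⊆ Q ∪ S → count P? ≤ count Q? + count S?
  count-⊎ S? P⊆Q∪S = begin
    count P?
      ≤⟨ ∑-mono-≤ (λ x → indicator-⊎ P⊆Q∪S (P? x) (Q? x) (S? x)) ⟩
    ∑[ x < m ] (indicator (Q? x) + indicator (S? x))
      ≡⟨ ∑-distrib-+ (indicator ∘ Q?) (indicator ∘ S?) ⟩
    count Q? + count S?
      ∎
    where open ≤-Reasoning

  count-∩ : ∀ {S} (S? : Decidable S) → P ⊆ S → Q ⊆ S →
            count P? + count Q? ≤ count S? + count (P? ∩? Q?)
  count-∩ S? P⊆S Q⊆S = begin
    count P? + count Q?
      ≡⟨ ∑-distrib-+ (indicator ∘ P?) (indicator ∘ Q?) ⟨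
    ∑[ x < m ] (indicator (P? x) + indicator (Q? x))
      ≤⟨ ∑-mono-≤ (λ x → indicator-∩ P⊆S Q⊆S (P? x) (Q? x) (S? x)) ⟩
    ∑[ x < m ] (indicator (S? x) + indicator ((P? ∩? Q?) x))
      ≡⟨ ∑-distrib-+ (indicator ∘ S?) (indicator ∘ (P? ∩? Q?)) ⟩
    count S? + count (P? ∩? Q?)
      ∎
    where open ≤-Reasoning

module FunctionalOrientation
  {m : ℕ} {V : Pred (Fin m) 0ℓ} (V? : Decidable V)
  {E : Rel (Fin m) 0ℓ} (E? : Decidable₂ E)
  (E-irrefl : ∀ {x y} → E x y → x ≢ y) (E-V : ∀ {x y} → E x y → V x × V y)
  {R : Rel (Fin m) 0ℓ} (R? : Decidable₂ R) (R⊆E : ∀ {x y} → R x y → E x y)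
  (orients : ∀ {x y} → E x y → R x y ⊎ R y x)
  (R-functional : ∀ {x y z} → R x y → R x z → y ≡ z)
  where

  deg indeg outdeg : Fin m → ℕ
  deg x    = count (E? x)
  indeg x  = count (λ y → R? y x)
  outdeg x = count (R? x)

  -- For a subgraph H this unfolds to DegH≥ H x 3, so ThreeLowDeg H is literally Distinct Low 3.
  High : Pred (Fin m) 0ℓ
  High x = Distinct (E x) 3

  high? : Decidable High
  high? x = distinct? (E? x) 3

  Low : Pred (Fin m) 0ℓ
  Low x = V x × ¬ High x

  low? : Decidable Low
  low? x = V? x ×-dec ¬? (high? x)

  highs lows : ℕ
  highs = count high?
  lows  = count low?

  Neighbour-other-than : Fin m → Fin m → Pred (Fin m) 0ℓ
  Neighbour-other-than x y z = E x z × z ≢ y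

  neighbour-other-than? : ∀ x y → Decidable (Neighbour-other-than x y)
  neighbour-other-than? x y z = E? x z ×-dec ¬? (z ≟ y)

  outdeg≤1 : ∀ x → outdeg x ≤ 1
  outdeg≤1 x = count≤-of-¬distinct (R? x) λ (f , f-inj , f∈R) →
    contradiction (f-inj (R-functional (f∈R 0F) (f∈R 1F))) λ ()

  outdeg≤[V] : ∀ x → outdeg x ≤ indicator (V? x)
  outdeg≤[V] x with V? x
  ... | yes _ = outdeg≤1 x
  ... | no ¬v = count≤-of-¬distinct (R? x) λ (_ , _ , f∈R) →
    ¬v (proj₁ (E-V (R⊆E (f∈R 0F))))

  high⇒2≤indeg : ∀ {x} → High x → 2 ≤ indeg x
  high⇒2≤indeg {x} hx = ≤-pred (begin
    3                     ≤⟨ distinct⇒≤count (E? x) hx ⟩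
    deg x                 ≤⟨ count-⊎ (E? x) (R? x) (λ y → R? y x) orients ⟩
    outdeg x + indeg x    ≤⟨ +-monoˡ-≤ (indeg x) (outdeg≤1 x) ⟩
    1 + indeg x           ∎)
    where open ≤-Reasoning

  ∑indeg≤highs+lows : ∑[ x < m ] indeg x ≤ highs + lows
  ∑indeg≤highs+lows = begin
    ∑[ x < m ] indeg x    ≡⟨ ∑-comm (λ x y → indicator (R? y x)) ⟩
    ∑[ y < m ] outdeg y   ≤⟨ ∑-mono-≤ outdeg≤[V] ⟩
    count V?              ≤⟨ count-⊎ V? high? low? high-or-low ⟩
    highs + lows          ∎
    where
    open ≤-Reasoning
    high-or-low : V ⊆ High ∪ Low
    high-or-low {x} v with high? x
    ... | yes hx = inj₁ hx
    ... | no ¬hx = inj₂ (v , ¬hx)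

  highs+∑≤lows : (w : Fin m → ℕ) →
                 (∀ x → indicator (high? x) + indicator (high? x) + w x ≤ indeg x) →
                 highs + ∑[ x < m ] w x ≤ lows
  highs+∑≤lows w charge≤indeg = +-cancelˡ-≤ highs _ _ (begin
    highs + (highs + ∑[ x < m ] w x)
      ≡⟨ +-assoc highs highs _ ⟨
    highs + highs + ∑[ x < m ] w x
      ≡⟨ cong (_+ _) (∑-distrib-+ [High] [High]) ⟨
    ∑[ x < m ] ([High] x + [High] x) + ∑[ x < m ] w x
      ≡⟨ ∑-distrib-+ (λ x → [High] x + [High] x) w ⟨
    ∑[ x < m ] ([High] x + [High] x + w x)
      ≤⟨ ∑-mono-≤ charge≤indeg ⟩
    ∑[ x < m ] indeg x
      ≤⟨ ∑indeg≤highs+lows ⟩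
    highs + lows
      ∎)
    where
    open ≤-Reasoning
    [High] : Fin m → ℕ
    [High] = indicator ∘ high?

  highs≤lows : highs ≤ lows
  highs≤lows = ≤-trans (m≤m+n highs _) (highs+∑≤lows (λ _ → 0) charge≤indeg)
    where
    charge≤indeg : ∀ x → indicator (high? x) + indicator (high? x) + 0 ≤ indeg x
    charge≤indeg x with high? x
    ... | yes hx = high⇒2≤indeg hx
    ... | no _   = z≤n

  highs<lows : ∀ {c} → ¬ High c → 1 ≤ indeg c → highs < lows
  highs<lows {c} ¬hc 1≤indeg =
    <-≤-trans (m<m+n highs (distinct⇒≤count (_≟ c) (distinct₁ {P = _≡ c} refl)))
              (highs+∑≤lows (λ x → indicator (x ≟ c)) charge≤indeg)
    where
    charge≤indeg : ∀ x → indicator (high? x) + indicator (high? x) + indicator (x ≟ c) ≤ indeg x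
    charge≤indeg x with high? x | x ≟ c
    ... | yes hx | yes refl = contradiction hx ¬hc
    ... | yes hx | no _     = high⇒2≤indeg hx
    ... | no _   | yes refl = 1≤indeg
    ... | no _   | no _     = z≤n

  high⇒2≤neighbours-other-than : ∀ {x} y → High x → 2 ≤ count (neighbour-other-than? x y)
  high⇒2≤neighbours-other-than {x} y hx = ≤-pred (begin
    3                                                 ≤⟨ distinct⇒≤count (E? x) hx ⟩
    deg x                                             ≤⟨ count-⊎ (E? x) N? (_≟ y) split ⟩
    count N? + count (_≟ y)                           ≤⟨ +-monoʳ-≤ _ (count≤-of-¬distinct (_≟ y) ¬two-y) ⟩
    count N? + 1                                      ≡⟨ +-comm _ 1 ⟩
    suc (count N?)                                    ∎)
    where
    open ≤-Reasoning
    N? : Decidable (Neighbour-other-than x y)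
    N? = neighbour-other-than? x y
    split : E x ⊆ Neighbour-other-than x y ∪ (_≡ y)
    split {z} exz with z ≟ y
    ... | yes z≡y = inj₂ z≡y
    ... | no z≢y  = inj₁ (exz , z≢y)
    ¬two-y : ¬ Distinct (_≡ y) 2
    ¬two-y (f , f-inj , f≡y) = contradiction (f-inj (trans (f≡y 0F) (sym (f≡y 1F)))) λ ()

  module _ (lows≤2 : lows ≤ 2) where

    ¬three-lows : ¬ Distinct Low 3
    ¬three-lows three = ≤⇒≯ lows≤2 (distinct⇒≤count low? three)

    ¬three-highs : ¬ Distinct High 3
    ¬three-highs three = ≤⇒≯ (≤-trans highs≤lows lows≤2) (distinct⇒≤count high? three)

    other-neighbour-is-low : ∀ {x y} → x ≢ y → High x → High y →
                             Neighbour-other-than x y ⊆ Low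
    other-neighbour-is-low x≢y hx hy (exz , z≢y) = proj₂ (E-V exz) , λ hz →
      ¬three-highs (distinct₃ x≢y (E-irrefl exz) (z≢y ∘ sym) hx hy hz)

    ¬common-low-neighbour : ∀ {x y c} → x ≢ y → High x → High y → Low c → E x c → E y c → ⊥
    ¬common-low-neighbour {x} {y} {c} x≢y hx hy low-c exc eyc =
      ¬orientable (orients exc) (orients eyc)
      where
      2≤highs : 2 ≤ highs
      2≤highs = distinct⇒≤count high? (distinct₂ x≢y hx hy)
      ¬inflow : ∀ {w} → R w c → ⊥
      ¬inflow rwc = ≤⇒≯ (≤-trans (highs<lows (proj₂ low-c) 1≤indeg) lows≤2) (s≤s 2≤highs)
        where
        1≤indeg : 1 ≤ indeg c
        1≤indeg = distinct⇒≤count (λ w → R? w c) (distinct₁ {P = λ w → R w c} rwc)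
      ¬orientable : R x c ⊎ R c x → R y c ⊎ R c y → ⊥
      ¬orientable (inj₁ rxc) _          = ¬inflow rxc
      ¬orientable _          (inj₁ ryc) = ¬inflow ryc
      ¬orientable (inj₂ rcx) (inj₂ rcy) = x≢y (R-functional rcx rcy)

    ¬adjacent-highs : ∀ {x y} → E x y → High x → High y → ⊥
    ¬adjacent-highs {x} {y} exy hx hy =
      let c , (exc , c≢y) , (eyc , _) = count-witness (A? ∩? B?) (≤-trans (n≤1+n 1) 2≤common)
      in  ¬common-low-neighbour x≢y hx hy (other-neighbour-is-low x≢y hx hy (exc , c≢y)) exc eyc
      where
      x≢y : x ≢ y
      x≢y = E-irrefl exy
      A? : Decidable (Neighbour-other-than x y)
      A? = neighbour-other-than? x y
      B? : Decidable (Neighbour-other-than y x)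
      B? = neighbour-other-than? y x
      2≤common : 2 ≤ count (A? ∩? B?)
      2≤common = +-cancelˡ-≤ 2 _ _ (begin
        2 + 2                     ≤⟨ +-mono-≤ (high⇒2≤neighbours-other-than y hx)
                                              (high⇒2≤neighbours-other-than x hy) ⟩
        count A? + count B?       ≤⟨ count-∩ A? B? low? (other-neighbour-is-low x≢y hx hy)
                                                        (other-neighbour-is-low (x≢y ∘ sym) hy hx) ⟩
        lows + count (A? ∩? B?)   ≤⟨ +-monoˡ-≤ _ lows≤2 ⟩
        2 + count (A? ∩? B?)      ∎)
        where open ≤-Reasoning

    ¬high : ∀ {x} → ¬ High x
    ¬high {x} hx with any? (λ y → E? x y ×-dec high? y)
    ... | yes (y , exy , hy) = ¬adjacent-highs exy hx hy
    ... | no ¬high-neighbour = ≤⇒≯ lows≤2 (begin-strict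
      2      <⟨ distinct⇒≤count (E? x) hx ⟩
      deg x  ≤⟨ count-mono (E? x) low? neighbour-low ⟩
      lows   ∎)
      where
      open ≤-Reasoning
      neighbour-low : E x ⊆ Low
      neighbour-low {y} exy = proj₂ (E-V exy) , λ hy → ¬high-neighbour (y , exy , hy)

    vertices-on-edge : ∀ {i j k} → E i j → V k → k ≡ i ⊎ k ≡ j
    vertices-on-edge {i} {j} {k} eij vk with k ≟ i | k ≟ j
    ... | yes k≡i | _       = inj₁ k≡i
    ... | no _    | yes k≡j = inj₂ k≡j
    ... | no k≢i  | no k≢j  = ⊥-elim (¬three-lows (distinct₃ (E-irrefl eij) (k≢i ∘ sym) (k≢j ∘ sym)
                                                              (low vi) (low vj) (low vk)))
      where
      low : V ⊆ Low
      low v = v , ¬high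
      vi : V i
      vi = proj₁ (E-V eij)
      vj : V j
      vj = proj₂ (E-V eij)

  three-lows-or-spanned-by : ∀ {i j} → E i j → Distinct Low 3 ⊎ (∀ k → V k → k ≡ i ⊎ k ≡ j)
  three-lows-or-spanned-by eij with distinct? low? 3
  ... | yes three = inj₁ three
  ... | no ¬three = inj₂ λ k → vertices-on-edge (count≤-of-¬distinct low? ¬three) eij

∃-Bool? : {P : Bool → Set} → (∀ b → Dec (P b)) → Dec (∃[ b ] P b)
∃-Bool? P? = map′ [ (false ,_) , (true ,_) ]′ (λ { (false , p) → inj₁ p ; (true , p) → inj₂ p })
                  (P? false ⊎-dec P? true)

module _ {n : ℕ} (G : Graph n) {m : ℕ} (M : Matching G m) where
  open Graph G renaming (sym to Adj-sym)
  open Matching M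

  inVM? : Decidable (InVM G M)
  inVM? v = any? λ i → ∃-Bool? λ a → ends i a ≟ v

  degGM≥? : ∀ p k → Dec (DegGM≥ G M p k)
  degGM≥? p = distinct? (λ v → inVM? v ×-dec adj? p v)

  redDir? : Decidable₂ (RedDir G M)
  redDir? i j = ∃-Bool? λ a → ∃-Bool? λ b →
    adj? _ _ ×-dec (degGM≥? _ 2 ×-dec ¬? (degGM≥? _ 3)) ×-dec degGM≥? _ 3

  ends-≢ : ∀ {i j} → i ≢ j → ∀ a b → ends i a ≢ ends j b
  ends-≢ i≢j a b eq = i≢j (proj₁ (ends-inj _ _ _ _ eq))

  ends-adjacent : ∀ i a → Adj (ends i a) (ends i (not a))
  ends-adjacent i false = ends-edge i
  ends-adjacent i true  = Adj-sym (ends-edge i)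

  -- Witnesses with the same degree-2 endpoint p give p three neighbours in G[M]; witnesses with
  -- different ones make the other endpoint of e_i have degree both 2 and more than 2.
  redDir-functional : ∀ {i j k} → i ≢ j → i ≢ k → RedDir G M i j → RedDir G M i k → j ≡ k
  redDir-functional {i} {j} {k} i≢j i≢k
    (a , b , p~r , (_ , ¬deg3-p) , deg3-q) (a′ , b′ , p′~r′ , (_ , ¬deg3-p′) , _)
    with a Bool.≟ a′ | j ≟ k
  ... | _        | yes j≡k = j≡k
  ... | yes refl | no j≢k  = ⊥-elim (¬deg3-p (distinct₃ {P = λ v → InVM G M v × Adj (ends i a) v}
      (ends-≢ i≢j _ _) (ends-≢ i≢k _ _) (ends-≢ j≢k _ _)
      ((i , not a , refl) , ends-adjacent i a) ((j , b , refl) , p~r) ((k , b′ , refl) , p′~r′)))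
  ... | no a≢a′  | no _    =
    ⊥-elim (¬deg3-p′ (subst (λ c → DegGM≥ G M (ends i c) 3) (sym (¬-not (a≢a′ ∘ sym))) deg3-q))

module RedArcs {n m : ℕ} {G : Graph n} {M : Matching G m} (H : SubgraphGM G M) where
  open SubgraphGM H

  RedArc : Rel (Fin m) 0ℓ
  RedArc i j = E i j × RedDir G M i j

  redArc? : Decidable₂ RedArc
  redArc? i j = E? i j ×-dec redDir? G M i j

  redArc-functional : ∀ {i j k} → RedArc i j → RedArc i k → j ≡ k
  redArc-functional (eij , rij) (eik , rik) =
    redDir-functional G M (proj₁ (E-sub eij)) (proj₁ (E-sub eik)) rij rik

  redArcs-orient : AllRed H → ∀ {i j} → E i j → RedArc i j ⊎ RedArc j i
  redArcs-orient all-red eij with proj₂ (all-red eij)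
  ... | inj₁ rij = inj₁ (eij , rij)
  ... | inj₂ rji = inj₂ (E-sym eij , rji)

lemma3 : {n m : ℕ} (G : Graph n) (M : Matching G m) (H : SubgraphGM G M) →
    HasEdge H → AllRed H → ThreeLowDeg H ⊎ IsK2 H
lemma3 G M H (i , j , eij) all-red =
  map₂ (λ spanned → i , j , proj₁ (E-sub eij) , eij , spanned) (three-lows-or-spanned-by eij)
  where
  open SubgraphGM H
  open RedArcs H
  open FunctionalOrientation V? E? (proj₁ ∘ E-sub) E-V
                             redArc? proj₁ (redArcs-orient all-red) redArc-functional
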